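{- Let $q$ be a prime power and let $a,b$ be integers with $a\geq 2$ and $b\geq0$. Then \[ \varphi^{ - }_{b+1,b+a}(q)\leq q^{ab+\binom{a+1}{2}}\left(1+(-1)^{b}q^{ -b-a}\frac{q^{a}-(-1)^{a}}{q+1}-q^{ -2b-a-1}\right). \]
   Context: For integers $b\ge a\ge0$, $\varphi^{ - }_{a,b}(q)=\prod_{k=a}^{b}(q^k-(-1)^k)$. -}

module Defs where

open import Data.Nat as ℕ using (ℕ; zero; suc; _+_; _*_; _≤_)
open import Data.Nat.Properties using (m^n≢0)
open import Data.Nat.Primality using (Prime)
open import Data.Integer as ℤ using (ℤ; +_; -1ℤ)
open import Data.Rational as ℚ using (ℚ; _/_)
open import Data.Product using (Σ; _×_)
open import Relation.Binary.PropositionalEquality using (_≡_)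

IsPrimePower : ℕ → Set
IsPrimePower q = Σ ℕ λ p → Σ ℕ λ k → Prime p × 1 ≤ k × q ≡ p ℕ.^ k

prodFrom : (ℕ → ℤ) → ℕ → ℕ → ℤ
prodFrom f a zero = + 1
prodFrom f a (suc len) = f a ℤ.* prodFrom f (suc a) len

-- φ⁻_{a,b}(q) = ∏_{k=a}^{b} (q^k - (-1)^k)   (intended for b ≥ a)
phiMinus : ℕ → ℕ → ℕ → ℤ
phiMinus q a b = prodFrom (λ k → (+ q) ℤ.^ k ℤ.- -1ℤ ℤ.^ k) a (suc b ℕ.∸ a)

toℚ : ℤ → ℚ
toℚ z = z / 1

-- q ^ (-n) as a rational (q ≥ 1; the q = 0 clause is a dummy never used for prime powers)
qInvPow : ℕ → ℕ → ℚ
qInvPow zero n = ℚ.0ℚ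
qInvPow (suc m) n = + 1 / (suc m ℕ.^ n)
  where instance _ = m^n≢0 (suc m) n

module Submission where

-- Multiplied out, the bound is the integer  q^M (q^(2b+a+1) + (-1)^b q^(b+1) S_a - 1),  where
-- S_a = (q^a - (-1)^a)/(q+1) = q^(a-1) - q^(a-2) + ... ± 1  and  M = (b+2) + ... + (b+a-1).
-- For a = 2 it equals the product of the two factors. Splitting off the first factor
-- q^(b+1) + (-1)^b, which is nonnegative, the bound for a+1 factors exceeds that factor times
-- the bound for a factors starting at b+2 by  q^M' (q^(b+2) (S_a - 1) + q^(b+1) + (-1)^b) ≥ 0,
-- as S_a ≥ 1; induction on a then proves the inequality in ℤ, and it transfers to ℚ.

open import Defs
open import Data.Nat as ℕ using (ℕ; zero; suc; s≤s; z≤n)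
import Data.Nat.Properties as ℕₚ
open import Data.Nat.Primality using (prime⇒nonTrivial; prime⇒nonZero)
open import Data.Integer as ℤ using (ℤ; +_; -1ℤ)
import Data.Integer.Properties as ℤₚ
open import Data.Rational as ℚ using (ℚ; _/_)
import Data.Rational.Properties as ℚₚ
open import Data.List using (_∷_; [])
open import Data.Product using (_,_)
open import Data.Sum using (_⊎_; inj₁; inj₂)
open import Relation.Binary.PropositionalEquality
  using (_≡_; refl; sym; trans; cong; cong₂; subst; subst₂; module ≡-Reasoning)

sumFrom : ℕ → ℕ → ℕ
sumFrom x zero = 0
sumFrom x (suc n) = x ℕ.+ sumFrom (suc x) n

module IntegerBound where

  open import Data.Integer using (ℤ; 0ℤ; 1ℤ; _+_; _-_; _*_; _^_; _≤_; +≤+; -≤+; nonNegative)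
  open import Data.Integer.Properties
    using ( module ≤-Reasoning; ≤-refl; ≤-reflexive; ≤-trans; +-mono-≤; i≤i+j; i≤j⇒0≤j-i
          ; *-monoˡ-≤-nonNeg; *-zeroʳ; pos-*; ^-distribˡ-+-*)
  open import Data.Integer.Tactic.RingSolver using (solve; solve-∀)

  -1ℤ^n≡±1 : ∀ n → -1ℤ ^ n ≡ 1ℤ ⊎ -1ℤ ^ n ≡ -1ℤ
  -1ℤ^n≡±1 zero = inj₁ refl
  -1ℤ^n≡±1 (suc n) with -1ℤ^n≡±1 n
  ... | inj₁ eq = inj₂ (cong (-1ℤ *_) eq)
  ... | inj₂ eq = inj₁ (cong (-1ℤ *_) eq)

  -1ℤ≤-1ℤ^n : ∀ n → -1ℤ ≤ -1ℤ ^ n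
  -1ℤ≤-1ℤ^n n with -1ℤ^n≡±1 n
  ... | inj₁ eq rewrite eq = -≤+
  ... | inj₂ eq rewrite eq = ≤-refl

  -1ℤ^n≤1ℤ : ∀ n → -1ℤ ^ n ≤ 1ℤ
  -1ℤ^n≤1ℤ n with -1ℤ^n≡±1 n
  ... | inj₁ eq rewrite eq = ≤-refl
  ... | inj₂ eq rewrite eq = -≤+

  pos-^ : ∀ m n → + (m ℕ.^ n) ≡ (+ m) ^ n
  pos-^ m zero = refl
  pos-^ m (suc n) = trans (pos-* m (m ℕ.^ n)) (cong (+ m *_) (pos-^ m n))

  0≤q^n : ∀ q n → 0ℤ ≤ (+ q) ^ n
  0≤q^n q n = subst (0ℤ ≤_) (pos-^ q n) (+≤+ z≤n)

  1≤q^n : ∀ q .{{_ : ℕ.NonZero q}} n → 1ℤ ≤ (+ q) ^ n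
  1≤q^n q n = subst (1ℤ ≤_) (pos-^ q n) (+≤+ (ℕₚ.m^n>0 q n))

  0≤i⇒0≤j⇒0≤i*j : ∀ {i j} → 0ℤ ≤ i → 0ℤ ≤ j → 0ℤ ≤ i * j
  0≤i⇒0≤j⇒0≤i*j (+≤+ {n = m} _) (+≤+ {n = n} _) = subst (0ℤ ≤_) (pos-* m n) (+≤+ z≤n)

  factor : ℕ → ℕ → ℤ
  factor q k = (+ q) ^ k - -1ℤ ^ k

  0≤factor : ∀ q .{{_ : ℕ.NonZero q}} k → 0ℤ ≤ factor q k
  0≤factor q k = i≤j⇒0≤j-i (≤-trans (-1ℤ^n≤1ℤ k) (1≤q^n q k))

  altSum : ℕ → ℕ → ℤ
  altSum q zero = 0ℤ
  altSum q (suc a) = (+ q) ^ a - altSum q a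

  [1+q]*altSum≡q^a-[-1]^a : ∀ q a → + suc q * altSum q a ≡ (+ q) ^ a - -1ℤ ^ a
  [1+q]*altSum≡q^a-[-1]^a q zero = *-zeroʳ (+ suc q)
  [1+q]*altSum≡q^a-[-1]^a q (suc a) = begin
    (1ℤ + Q) * (P - S)           ≡⟨ distrib Q P S ⟩
    (1ℤ + Q) * P - (1ℤ + Q) * S  ≡⟨ cong (λ t → (1ℤ + Q) * P - t) ([1+q]*altSum≡q^a-[-1]^a q a) ⟩
    (1ℤ + Q) * P - (P - E)       ≡⟨ collect Q P E ⟩
    Q * P - -1ℤ * E              ∎
    where
      open ≡-Reasoning
      Q = + q
      P = Q ^ a
      S = altSum q a
      E = -1ℤ ^ a
      distrib : ∀ Q P S → (1ℤ + Q) * (P - S) ≡ (1ℤ + Q) * P - (1ℤ + Q) * S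
      distrib = solve-∀
      collect : ∀ Q P E → (1ℤ + Q) * P - (P - E) ≡ Q * P - -1ℤ * E
      collect = solve-∀

  1≤altSum : ∀ {q} → 2 ℕ.≤ q → ∀ a → 1ℤ ≤ altSum q (suc a)
  1≤altSum _ zero = ≤-refl
  1≤altSum (s≤s (s≤s _)) (suc zero) = +≤+ (s≤s z≤n)
  1≤altSum {q} 2≤q@(s≤s (s≤s _)) (suc (suc a)) =
    subst (1ℤ ≤_) (sym (regroup Q P (altSum q (suc a))))
      (+-mono-≤ (0≤i⇒0≤j⇒0≤i*j (0≤q^n q (suc a)) (i≤j⇒0≤j-i (+≤+ (s≤s z≤n)))) (1≤altSum 2≤q a))
    where
      Q = + q
      P = Q ^ suc a
      regroup : ∀ Q P S → Q * P - (P - S) ≡ P * (Q - 1ℤ) + S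
      regroup = solve-∀

  -- The bound for the a = 2 + c factors from k = b + 1 on, with its denominators cleared.
  upperBound : ℕ → ℕ → ℕ → ℤ
  upperBound q c b =
    Q ^ sumFrom (suc (suc b)) c * (X * X * Q ^ suc c + -1ℤ ^ b * X * altSum q (suc (suc c)) - 1ℤ)
    where
      Q = + q
      X = Q ^ suc b

  gap : ℕ → ℕ → ℕ → ℤ
  gap q c b =
    Q ^ sumFrom (suc (suc (suc b))) c * (X * (Q * (altSum q (suc (suc c)) - 1ℤ)) + (X + -1ℤ ^ b))
    where
      Q = + q
      X = Q ^ suc b

  0≤gap : ∀ {q} → 2 ℕ.≤ q → ∀ c b → 0ℤ ≤ gap q c b
  0≤gap {q} 2≤q@(s≤s _) c b =
    0≤i⇒0≤j⇒0≤i*j (0≤q^n q (sumFrom (suc (suc (suc b))) c)) (+-mono-≤ 0≤X*[Q*[S-1]] 0≤X+e)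
    where
      0≤X*[Q*[S-1]] : 0ℤ ≤ (+ q) ^ suc b * (+ q * (altSum q (suc (suc c)) - 1ℤ))
      0≤X*[Q*[S-1]] = 0≤i⇒0≤j⇒0≤i*j (0≤q^n q (suc b))
        (0≤i⇒0≤j⇒0≤i*j (+≤+ {n = q} z≤n) (i≤j⇒0≤j-i (1≤altSum 2≤q (suc c))))
      0≤X+e : 0ℤ ≤ (+ q) ^ suc b + -1ℤ ^ b
      0≤X+e = +-mono-≤ (1≤q^n q (suc b)) (-1ℤ≤-1ℤ^n b)

  prodFrom-factor-2≡upperBound : ∀ q b → prodFrom (factor q) (suc b) 2 ≡ upperBound q 0 b
  prodFrom-factor-2≡upperBound q b = identity (+ q) ((+ q) ^ suc b) (-1ℤ ^ b) (-1ℤ^n≡±1 b)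
    where
      identity : ∀ Q X e → e ≡ 1ℤ ⊎ e ≡ -1ℤ →
        (X - -1ℤ * e) * ((Q * X - -1ℤ * (-1ℤ * e)) * 1ℤ)
          ≡ 1ℤ * (X * X * (Q * 1ℤ) + e * X * (Q * 1ℤ - (1ℤ - 0ℤ)) - 1ℤ)
      identity Q X _ (inj₁ refl) = solve (Q ∷ X ∷ [])
      identity Q X _ (inj₂ refl) = solve (Q ∷ X ∷ [])

  upperBound-suc : ∀ q c b →
    upperBound q (suc c) b ≡ factor q (suc b) * upperBound q c (suc b) + gap q c b
  upperBound-suc q c b = begin
    Q ^ (suc (suc b) ℕ.+ E) * bracket  ≡⟨ cong (_* bracket) (^-distribˡ-+-* Q (suc (suc b)) E) ⟩
    Q * X * m * bracket                ≡⟨ identity Q X (Q ^ suc c) m (altSum q (suc (suc c))) e (-1ℤ^n≡±1 b) ⟩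
    factor q (suc b) * upperBound q c (suc b) + gap q c b ∎
    where
      open ≡-Reasoning
      Q = + q
      X = Q ^ suc b
      E = sumFrom (suc (suc (suc b))) c
      m = Q ^ E
      e = -1ℤ ^ b
      bracket = X * X * (Q * Q ^ suc c) + e * X * altSum q (suc (suc (suc c))) - 1ℤ
      identity : ∀ Q X Y m S e → e ≡ 1ℤ ⊎ e ≡ -1ℤ →
        Q * X * m * (X * X * (Q * Y) + e * X * (Q * Y - S) - 1ℤ)
          ≡ (X - -1ℤ * e) * (m * (Q * X * (Q * X) * Y + -1ℤ * e * (Q * X) * S - 1ℤ))
            + m * (X * (Q * (S - 1ℤ)) + (X + e))
      identity Q X Y m S _ (inj₁ refl) = solve (Q ∷ X ∷ Y ∷ m ∷ S ∷ [])
      identity Q X Y m S _ (inj₂ refl) = solve (Q ∷ X ∷ Y ∷ m ∷ S ∷ [])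

  prodFrom-factor≤upperBound : ∀ {q} → 2 ℕ.≤ q → ∀ c b →
    prodFrom (factor q) (suc b) (suc (suc c)) ≤ upperBound q c b
  prodFrom-factor≤upperBound {q} _ zero b = ≤-reflexive (prodFrom-factor-2≡upperBound q b)
  prodFrom-factor≤upperBound {q} 2≤q@(s≤s _) (suc c) b = begin
    factor q (suc b) * prodFrom (factor q) (suc (suc b)) (suc (suc c))
      ≤⟨ *-monoˡ-≤-nonNeg (factor q (suc b)) {{nonNegative (0≤factor q (suc b))}}
           (prodFrom-factor≤upperBound 2≤q c (suc b)) ⟩
    factor q (suc b) * upperBound q c (suc b)
      ≤⟨ i≤i+j (factor q (suc b) * upperBound q c (suc b)) (gap q c b) {{nonNegative (0≤gap 2≤q c b)}} ⟩
    factor q (suc b) * upperBound q c (suc b) + gap q c b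
      ≡⟨ upperBound-suc q c b ⟨
    upperBound q (suc c) b ∎
    where open ≤-Reasoning

open IntegerBound

module RationalEmbedding where

  open import Data.Rational using (mkℚ; _≤_; _+_; _*_; _-_; 1ℚ; *≤*)
  import Data.Rational.Unnormalised as ℚᵘ
  open import Data.Nat.Coprimality using (1-coprimeTo) renaming (sym to coprime-sym)
  open import Data.Rational.Solver using (module +-*-Solver)

  -- Arithmetic on  mkℚ i 0  computes, whereas on  i / 1  it is stuck in the gcd of the normalisation.
  toℚ≡mkℚ : ∀ i → toℚ i ≡ mkℚ i 0 (coprime-sym (1-coprimeTo ℤ.∣ i ∣))
  toℚ≡mkℚ i = ℚₚ.↥p/↧p≡p (mkℚ i 0 _)

  toℚ-homo-* : ∀ i j → toℚ (i ℤ.* j) ≡ toℚ i * toℚ j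
  toℚ-homo-* i j = sym (cong₂ _*_ (toℚ≡mkℚ i) (toℚ≡mkℚ j))

  toℚ-homo-+ : ∀ i j → toℚ (i ℤ.+ j) ≡ toℚ i + toℚ j
  toℚ-homo-+ i j = sym (trans (cong₂ _+_ (toℚ≡mkℚ i) (toℚ≡mkℚ j))
    (cong toℚ (cong₂ ℤ._+_ (ℤₚ.*-identityʳ i) (ℤₚ.*-identityʳ j))))

  toℚ-mono-≤ : ∀ {i j} → i ℤ.≤ j → toℚ i ≤ toℚ j
  toℚ-mono-≤ {i} {j} i≤j =
    subst₂ _≤_ (sym (toℚ≡mkℚ i)) (sym (toℚ≡mkℚ j)) (*≤* (ℤₚ.*-monoʳ-≤-nonNeg (+ 1) i≤j))

  toℚ-homo-bracket : ∀ (m x y e s : ℤ) →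
    toℚ (m ℤ.* (x ℤ.* x ℤ.* y ℤ.+ e ℤ.* x ℤ.* s ℤ.- ℤ.1ℤ))
      ≡ toℚ m * (toℚ x * toℚ x * toℚ y + toℚ e * toℚ x * toℚ s - 1ℚ)
  toℚ-homo-bracket m x y e s = begin
    toℚ (m ℤ.* (x ℤ.* x ℤ.* y ℤ.+ e ℤ.* x ℤ.* s ℤ.+ -1ℤ))
      ≡⟨ toℚ-homo-* m (x ℤ.* x ℤ.* y ℤ.+ e ℤ.* x ℤ.* s ℤ.+ -1ℤ) ⟩
    toℚ m * toℚ (x ℤ.* x ℤ.* y ℤ.+ e ℤ.* x ℤ.* s ℤ.+ -1ℤ)
      ≡⟨ cong (toℚ m *_) (toℚ-homo-+ (x ℤ.* x ℤ.* y ℤ.+ e ℤ.* x ℤ.* s) -1ℤ) ⟩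
    toℚ m * (toℚ (x ℤ.* x ℤ.* y ℤ.+ e ℤ.* x ℤ.* s) - 1ℚ)
      ≡⟨ cong (λ t → toℚ m * (t - 1ℚ)) (toℚ-homo-+ (x ℤ.* x ℤ.* y) (e ℤ.* x ℤ.* s)) ⟩
    toℚ m * (toℚ (x ℤ.* x ℤ.* y) + toℚ (e ℤ.* x ℤ.* s) - 1ℚ)
      ≡⟨ cong₂ (λ t t′ → toℚ m * (t + t′ - 1ℚ)) (toℚ-homo-*³ x x y) (toℚ-homo-*³ e x s) ⟩
    toℚ m * (toℚ x * toℚ x * toℚ y + toℚ e * toℚ x * toℚ s - 1ℚ) ∎
    where
      open ≡-Reasoning
      toℚ-homo-*³ : ∀ i j k → toℚ (i ℤ.* j ℤ.* k) ≡ toℚ i * toℚ j * toℚ k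
      toℚ-homo-*³ i j k = trans (toℚ-homo-* (i ℤ.* j) k) (cong (_* toℚ k) (toℚ-homo-* i j))

  n*i/n≡i/1 : ∀ n i → (+ suc n ℤ.* i) / suc n ≡ i / 1
  n*i/n≡i/1 n i = ℚₚ.fromℚᵘ-cong {ℚᵘ.mkℚᵘ (+ suc n ℤ.* i) n} {ℚᵘ.mkℚᵘ i 0}
    (ℚᵘ.*≡* (trans (ℤₚ.*-identityʳ _) (ℤₚ.*-comm (+ suc n) i)))

  [q^a-[-1]^a]/[1+q]≡altSum : ∀ q a → ((+ q) ℤ.^ a ℤ.- -1ℤ ℤ.^ a) / suc q ≡ toℚ (altSum q a)
  [q^a-[-1]^a]/[1+q]≡altSum q a =
    trans (cong (_/ suc q) (sym ([1+q]*altSum≡q^a-[-1]^a q a))) (n*i/n≡i/1 q (altSum q a))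

  _^ℚ_ : ℕ → ℕ → ℚ
  q ^ℚ n = toℚ ((+ q) ℤ.^ n)

  ^ℚ-distribˡ-+-* : ∀ q m n → q ^ℚ (m ℕ.+ n) ≡ q ^ℚ m * q ^ℚ n
  ^ℚ-distribˡ-+-* q m n =
    trans (cong toℚ (ℤₚ.^-distribˡ-+-* (+ q) m n)) (toℚ-homo-* ((+ q) ℤ.^ m) ((+ q) ℤ.^ n))

  toℚ[n]*[1/n]≡1 : ∀ n .{{_ : ℕ.NonZero n}} → toℚ (+ n) * (+ 1 / n) ≡ 1ℚ
  toℚ[n]*[1/n]≡1 (suc k) =
    trans (cong₂ _*_ (toℚ≡mkℚ (+ suc k)) (ℚₚ.↥p/↧p≡p (mkℚ (+ 1) k (1-coprimeTo (suc k)))))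
          (ℚₚ.*-inverseʳ (mkℚ (+ suc k) 0 (coprime-sym (1-coprimeTo (suc k)))))

  q^ℚn*qInvPow≡1 : ∀ p n → suc p ^ℚ n * qInvPow (suc p) n ≡ 1ℚ
  q^ℚn*qInvPow≡1 p n = trans (cong (λ i → toℚ i * qInvPow (suc p) n) (sym (pos-^ (suc p) n)))
    (toℚ[n]*[1/n]≡1 (suc p ℕ.^ n) {{ℕₚ.m^n≢0 (suc p) n}})

  clear-inverses : ∀ (m x y e s u v : ℚ) → x * y * u ≡ 1ℚ → x * x * y * v ≡ 1ℚ →
    m * (x * x * y) * (1ℚ + e * u * s - v) ≡ m * (x * x * y + e * x * s - 1ℚ)
  clear-inverses m x y e s u v xyu≡1 xxyv≡1 = begin
    m * (x * x * y) * (1ℚ + e * u * s - v)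
      ≡⟨ expand m x y e s u v ⟩
    m * (x * x * y + e * x * s * (x * y * u) - x * x * y * v)
      ≡⟨ cong₂ (λ t t′ → m * (x * x * y + e * x * s * t - t′)) xyu≡1 xxyv≡1 ⟩
    m * (x * x * y + e * x * s * 1ℚ - 1ℚ)
      ≡⟨ cong (λ t → m * (x * x * y + t - 1ℚ)) (ℚₚ.*-identityʳ (e * x * s)) ⟩
    m * (x * x * y + e * x * s - 1ℚ) ∎
    where
      open ≡-Reasoning
      open +-*-Solver
      expand : ∀ m x y e s u v →
        m * (x * x * y) * (1ℚ + e * u * s - v) ≡ m * (x * x * y + e * x * s * (x * y * u) - x * x * y * v)
      expand = solve 7 (λ m x y e s u v → m :* (x :* x :* y) :* (con 1ℚ :+ e :* u :* s :- v)
                         := m :* (x :* x :* y :+ e :* x :* s :* (x :* y :* u) :- x :* x :* y :* v)) refl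

open RationalEmbedding

open import Data.Nat using (_+_; _*_; _≤_)
open import Data.Nat.Combinatorics using (_C_; nC1≡n; nCk+nC[k+1]≡[n+1]C[k+1])
open import Data.Nat.Tactic.RingSolver using (solve-∀)

[1+n]C2≡n+nC2 : ∀ n → suc n C 2 ≡ n + n C 2
[1+n]C2≡n+nC2 n = trans (sym (nCk+nC[k+1]≡[n+1]C[k+1] n 1)) (cong (_+ n C 2) (nC1≡n n))

sumFrom≡n*x+nC2 : ∀ x n → sumFrom x n ≡ n * x + n C 2
sumFrom≡n*x+nC2 x zero = refl
sumFrom≡n*x+nC2 x (suc n) = begin
  x + sumFrom (suc x) n    ≡⟨ cong (λ t → x + t) (sumFrom≡n*x+nC2 (suc x) n) ⟩
  x + (n * suc x + n C 2)  ≡⟨ regroup x n (n C 2) ⟩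
  suc n * x + (n + n C 2)  ≡⟨ cong (λ t → suc n * x + t) ([1+n]C2≡n+nC2 n) ⟨
  suc n * x + suc n C 2    ∎
  where
    open ≡-Reasoning
    regroup : ∀ x n t → x + (n * suc x + t) ≡ suc n * x + (n + t)
    regroup = solve-∀

exponent-split : ∀ b c → (2 + c) * b + (3 + c) C 2 ≡ sumFrom (2 + b) c + (suc b + suc b + suc c)
exponent-split b c = begin
  (2 + c) * b + (3 + c) C 2
    ≡⟨ cong (λ t → (2 + c) * b + t) triangle ⟩
  (2 + c) * b + ((2 + c) + ((1 + c) + (c + c C 2)))
    ≡⟨ regroup b c (c C 2) ⟩
  (c * (2 + b) + c C 2) + (suc b + suc b + suc c)
    ≡⟨ cong (_+ (suc b + suc b + suc c)) (sumFrom≡n*x+nC2 (2 + b) c) ⟨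
  sumFrom (2 + b) c + (suc b + suc b + suc c) ∎
  where
    open ≡-Reasoning
    triangle : (3 + c) C 2 ≡ (2 + c) + ((1 + c) + (c + c C 2))
    triangle = trans ([1+n]C2≡n+nC2 (2 + c))
      (cong (λ t → 2 + c + t) (trans ([1+n]C2≡n+nC2 (1 + c)) (cong (λ t → 1 + c + t) ([1+n]C2≡n+nC2 c))))
    regroup : ∀ b c t →
      (2 + c) * b + ((2 + c) + ((1 + c) + (c + t))) ≡ (c * (2 + b) + t) + (suc b + suc b + suc c)
    regroup = solve-∀

upperBoundℚ : ℕ → ℕ → ℕ → ℚ
upperBoundℚ q a b = toℚ (+ (q ℕ.^ (a * b + (suc a C 2))))
  ℚ.* (ℚ.1ℚ
       ℚ.+ toℚ (-1ℤ ℤ.^ b) ℚ.* qInvPow q (b + a)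
           ℚ.* (((+ q) ℤ.^ a ℤ.- -1ℤ ℤ.^ a) / suc q)
       ℚ.- qInvPow q (2 * b + a + 1))

toℚ-upperBound : ∀ p c b → toℚ (upperBound (suc p) c b) ≡ upperBoundℚ (suc p) (2 + c) b
toℚ-upperBound p c b = begin
  toℚ (upperBound q c b)
    ≡⟨ toℚ-homo-bracket ((+ q) ℤ.^ E) ((+ q) ℤ.^ suc b) ((+ q) ℤ.^ suc c) (-1ℤ ℤ.^ b) (altSum q a) ⟩
  q ^ℚ E ℚ.* (x ℚ.* x ℚ.* y ℚ.+ ε ℚ.* x ℚ.* s ℚ.- ℚ.1ℚ)
    ≡⟨ clear-inverses (q ^ℚ E) x y ε s u v xyu≡1 xxyv≡1 ⟨
  q ^ℚ E ℚ.* (x ℚ.* x ℚ.* y) ℚ.* (ℚ.1ℚ ℚ.+ ε ℚ.* u ℚ.* s ℚ.- v)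
    ≡⟨ cong₂ (λ t d → t ℚ.* (ℚ.1ℚ ℚ.+ ε ℚ.* u ℚ.* d ℚ.- v))
             leading (sym ([q^a-[-1]^a]/[1+q]≡altSum q a)) ⟩
  upperBoundℚ q a b ∎
  where
    open ≡-Reasoning
    q = suc p
    a = 2 + c
    E = sumFrom (2 + b) c
    x = q ^ℚ suc b
    y = q ^ℚ suc c
    ε = toℚ (-1ℤ ℤ.^ b)
    s = toℚ (altSum q a)
    u = qInvPow q (b + a)
    v = qInvPow q (2 * b + a + 1)
    xxy : q ^ℚ (suc b + suc b + suc c) ≡ x ℚ.* x ℚ.* y
    xxy = trans (^ℚ-distribˡ-+-* q (suc b + suc b) (suc c))
                (cong (ℚ._* y) (^ℚ-distribˡ-+-* q (suc b) (suc b)))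
    xyu≡1 : x ℚ.* y ℚ.* u ≡ ℚ.1ℚ
    xyu≡1 = trans
      (cong₂ ℚ._*_ (sym (^ℚ-distribˡ-+-* q (suc b) (suc c))) (cong (qInvPow q) (ℕₚ.+-suc b (suc c))))
      (q^ℚn*qInvPow≡1 p (suc b + suc c))
    xxyv≡1 : x ℚ.* x ℚ.* y ℚ.* v ≡ ℚ.1ℚ
    xxyv≡1 = trans (cong₂ ℚ._*_ (sym xxy) (cong (qInvPow q) (regroup b c)))
      (q^ℚn*qInvPow≡1 p (suc b + suc b + suc c))
      where
        regroup : ∀ b c → 2 * b + (2 + c) + 1 ≡ suc b + suc b + suc c
        regroup = solve-∀
    leading : q ^ℚ E ℚ.* (x ℚ.* x ℚ.* y) ≡ toℚ (+ (q ℕ.^ (a * b + suc a C 2)))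
    leading = sym (begin
      toℚ (+ (q ℕ.^ (a * b + suc a C 2)))    ≡⟨ cong toℚ (pos-^ q (a * b + suc a C 2)) ⟩
      q ^ℚ (a * b + suc a C 2)               ≡⟨ cong (q ^ℚ_) (exponent-split b c) ⟩
      q ^ℚ (E + (suc b + suc b + suc c))     ≡⟨ ^ℚ-distribˡ-+-* q E (suc b + suc b + suc c) ⟩
      q ^ℚ E ℚ.* q ^ℚ (suc b + suc b + suc c) ≡⟨ cong (q ^ℚ E ℚ.*_) xxy ⟩
      q ^ℚ E ℚ.* (x ℚ.* x ℚ.* y)             ∎)

phiMinus≡prodFrom : ∀ q a b → phiMinus q (b + 1) (b + a) ≡ prodFrom (factor q) (suc b) a
phiMinus≡prodFrom q a b = cong₂ (prodFrom (factor q)) (ℕₚ.+-comm b 1)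
  (trans (cong (λ n → suc (b + a) ℕ.∸ n) (ℕₚ.+-comm b 1)) (ℕₚ.m+n∸m≡n b a))

phiMinus≤upperBoundℚ : ∀ q a b → 2 ≤ q → 2 ≤ a →
  toℚ (phiMinus q (b + 1) (b + a)) ℚ.≤ upperBoundℚ q a b
phiMinus≤upperBoundℚ (suc p) (suc (suc c)) b 2≤q (s≤s (s≤s z≤n)) = begin
  toℚ (phiMinus (suc p) (b + 1) (b + (2 + c)))     ≡⟨ cong toℚ (phiMinus≡prodFrom (suc p) (2 + c) b) ⟩
  toℚ (prodFrom (factor (suc p)) (suc b) (2 + c))  ≤⟨ toℚ-mono-≤ (prodFrom-factor≤upperBound 2≤q c b) ⟩
  toℚ (upperBound (suc p) c b)                     ≡⟨ toℚ-upperBound p c b ⟩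
  upperBoundℚ (suc p) (2 + c) b                    ∎
  where open ℚₚ.≤-Reasoning

IsPrimePower⇒2≤ : ∀ {q} → IsPrimePower q → 2 ≤ q
IsPrimePower⇒2≤ (p , suc k , p-prime , _ , refl) =
  ℕₚ.≤-trans (ℕ.nonTrivial⇒n>1 p) (ℕₚ.m≤m*n p (p ℕ.^ k) {{ℕₚ.m^n≢0 p k}})
  where instance
    _ = prime⇒nonTrivial p-prime
    _ = prime⇒nonZero p-prime

lemma2p11 : (q a b : ℕ) → IsPrimePower q → 2 ≤ a →
    toℚ (phiMinus q (b + 1) (b + a))
      ℚ.≤ toℚ (+ (q ℕ.^ (a * b + (suc a C 2))))
          ℚ.* (ℚ.1ℚ
               ℚ.+ toℚ (-1ℤ ℤ.^ b) ℚ.* qInvPow q (b + a)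
                   ℚ.* (((+ q) ℤ.^ a ℤ.- -1ℤ ℤ.^ a) / suc q)
               ℚ.- qInvPow q (2 * b + a + 1))
lemma2p11 q a b q-primePower = phiMinus≤upperBoundℚ q a b (IsPrimePower⇒2≤ q-primePower)
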